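{- Let $p\in\{3,4\}$. For every $p$-weighted graph $G=(V,w)$ there exists a set $K\subseteq V$ such that (i) $G[K]\in\mathcal{G}_p\big(p|K|-\tilde w(K)\big)$; (ii) $\gamma_K(y)\le p-1$ for all $y\in K$, and $\gamma_K(x)\ge p$ for all $x\in V\setminus K$; (iii) for all $x\in V\setminus K$ and $y\in K$, $\gamma_{K\setminus\{y\}}(x)\ge\gamma_K(y)$.
   Context: A $p$-weighted graph is a pair $G=(V,w)$ with $V$ finite and $w:V^2\to\{0,1,\dots,p\}$ symmetric with $w(x,x)=0$; $G[K]=(K,w|_{K^2})$; $G$ is positive if $w(x,y)>0$ for all $x\ne y$. Write $\tilde w(x,y):=p-w(x,y)$, $\tilde w(K):=\sum_{\{x,y\}\subseteq K,\,x\ne y}\tilde w(x,y)$, and $\gamma_K(x):=\sum_{y\in K\setminus\{x\}}\tilde w(x,y)$ for $x\in V$. For a positive $p$-weighted graph with enumeration $V=\{v_1,\dots,v_m\}$, an extension $w:V\to\{1,\dots,p\}$ is dominating if for every $j\in\{2,\dots,m\}$, writing $a=w(v_j)$, the multiset $\{w(v_i,v_j):i\in[j-1]\}$ dominates the multiset of $j-2$ copies of $\frac{p(a-1)}{a}+1$ and one copy of $a$ as ordered multisets (after sorting both non-decreasingly, entrywise $\ge$); its size is $\sum_v w(v)$. $\mathcal{G}_p(q)$ is the set of positive $p$-weighted graphs admitting an enumeration and a dominating extension of size at least $q$. -}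

module Defs where

open import Data.Nat using (ℕ; zero; suc; _+_; _*_; _∸_; _≤_; _<_; _<ᵇ_)
open import Data.Bool using (Bool; true; false; if_then_else_; _∧_; not)
open import Data.Fin using (Fin; toℕ; _≟_)
open import Data.Fin.Subset using (Subset; _∈_; ∣_∣)
open import Data.List using (List; []; _∷_; length; map; take; replicate; _++_; lookup; allFin)
open import Data.Nat.ListAction using (sum)
open import Data.List.Relation.Unary.Unique.Propositional using (Unique)
open import Data.List.Relation.Binary.Pointwise using (Pointwise)
import Data.List.Membership.Propositional as Mem
open import Data.Vec using () renaming (lookup to vlookup)
open import Data.Integer using (ℤ; +_; _-_) renaming (_≤_ to _≤ℤ_)
open import Data.Rational using (ℚ; _/_) renaming (_+_ to _+ℚ_; _≤_ to _≤ℚ_)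
open import Data.Rational.Properties using (≤-decTotalOrder)
import Data.List.Sort as Sort
open import Relation.Nullary using (¬_)
open import Relation.Nullary.Decidable using (⌊_⌋)
open import Relation.Binary.PropositionalEquality using (_≡_)
open import Data.Product using (Σ; _×_; _,_)
open import Function.Bundles using (_⇔_)

open Sort ≤-decTotalOrder using (sort)

record IsWeighted (p n : ℕ) (w : Fin n → Fin n → ℕ) : Set where
  field
    bounded : ∀ x y → w x y ≤ p
    symm    : ∀ x y → w x y ≡ w y x
    diag0   : ∀ x → w x x ≡ 0

inK : {n : ℕ} → Subset n → Fin n → Bool
inK K y = vlookup K y

wt : {n : ℕ} (p : ℕ) (w : Fin n → Fin n → ℕ) → Fin n → Fin n → ℕ
wt p w x y = p ∸ w x y

γ : {n : ℕ} (p : ℕ) (w : Fin n → Fin n → ℕ) → Subset n → Fin n → ℕ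
γ {n} p w K x =
  sum (map (λ y → if inK K y ∧ not ⌊ y ≟ x ⌋ then wt p w x y else 0) (allFin n))

-- w̃(K) = Σ over unordered pairs {x,y} ⊆ K, x ≠ y, of w̃(x,y)
-- (each unordered pair counted once, as the pair with toℕ x < toℕ y)
wtK : {n : ℕ} (p : ℕ) (w : Fin n → Fin n → ℕ) → Subset n → ℕ
wtK {n} p w K =
  sum (map (λ x → sum (map (λ y →
        if inK K x ∧ inK K y ∧ (toℕ x <ᵇ toℕ y) then wt p w x y else 0)
      (allFin n))) (allFin n))

Positive : {n : ℕ} → (Fin n → Fin n → ℕ) → Subset n → Set
Positive w K = ∀ x y → x ∈ K → y ∈ K → ¬ (x ≡ y) → 0 < w x y

Enumeration : {n : ℕ} → Subset n → List (Fin n) → Set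
Enumeration K L = Unique L × (∀ x → (x Mem.∈ L) ⇔ (x ∈ K))

ℕtoℚ : ℕ → ℚ
ℕtoℚ k = (+ k) / 1

-- Domination of ordered multisets: after sorting both non-decreasingly,
-- entrywise ≥.  `Dominates xs ys` means xs dominates ys.
Dominates : List ℚ → List ℚ → Set
Dominates xs ys = Pointwise (λ x y → y ≤ℚ x) (sort xs) (sort ys)

-- An extension w : V → {1,…,p} is given as e : Fin n → Fin p, with
-- w(v) = 1 + toℕ (e v)  (only its values on K matter).
extVal : {n p : ℕ} → (Fin n → Fin p) → Fin n → ℕ
extVal e v = suc (toℕ (e v))

-- the threshold p(a-1)/a + 1 for a ≥ 1, written with a = suc a'
thr : ℕ → ℕ → ℚ
thr p a' = ((+ (p * a')) / suc a') +ℚ ℕtoℚ 1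

-- dominating extension w.r.t. the enumeration L = v_1,…,v_m:
-- for every position i (0-based, j = i+1 ∈ {2,…,m}, i.e. i ≥ 1),
-- {w(v_k, v_j) : k < j} dominates (j-2)·{p(a-1)/a+1} ∪ {a}, a = w(v_j).
IsDominating : {n : ℕ} (p : ℕ) (w : Fin n → Fin n → ℕ) →
               (L : List (Fin n)) → (Fin n → Fin p) → Set
IsDominating p w L e =
  ∀ (i : Fin (length L)) → 1 ≤ toℕ i →
    let v = lookup L i
        a' = toℕ (e v)
    in Dominates (map (λ u → ℕtoℚ (w u v)) (take (toℕ i) L))
                 (replicate (toℕ i ∸ 1) (thr p a') ++ (ℕtoℚ (suc a') ∷ []))

extSize : {n p : ℕ} → (Fin n → Fin p) → List (Fin n) → ℕ
extSize e L = sum (map (extVal e) L)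

InG : {n : ℕ} (p : ℕ) (w : Fin n → Fin n → ℕ) (K : Subset n) (q : ℤ) → Set
InG p w K q =
  Positive w K ×
  Σ (List _) (λ L → Enumeration K L ×
    Σ (_ → Fin p) (λ e → IsDominating p w L e × (q ≤ℤ + extSize e L)))

-- Take K maximising 2(p|K| − w̃(K)) − |K|, that is, maximising p|K| − w̃(K) and of least size
-- among the maximisers. Because w̃(K ∪ {x}) = w̃(K) + γ_K(x) for x ∉ K, comparing K with K ∪ {x},
-- K − y and K − y + x gives (ii) and (iii).  For (i), enumerate K increasingly and give v the
-- value p − b(v), where b(v) is the w̃-weight between v and the earlier vertices; these values sum
-- to p|K| − w̃(K).  As b(v) ≤ γ_K(v) ≤ p − 1, at most one earlier u has p − w(u,v) > ⌊b(v)/2⌋,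
-- which is what domination needs; the remaining inequalities concern finitely many rationals
-- once p ∈ {3,4}, and are checked by evaluation.

module Submission where

open import Defs
open import Data.Nat using (ℕ; zero; suc; _+_; _*_; _∸_; _≤_; _<_; _≥_; z≤n; s≤s; _<ᵇ_; ⌊_/2⌋) renaming (_≤?_ to _≤ℕ?_)
open import Data.Nat.Properties using (+-mono-≤; +-monoʳ-≤; m≤m+n; m≤n+m; ≤-trans; ≤-reflexive; +-identityʳ; +-assoc; +-comm; <-cmp; <⇒≯; <⇒≱; <⇒≤; n≮n; <-irrefl; <⇒<ᵇ; <ᵇ⇒<; ≤-pred; +-cancelˡ-≤; +-cancelˡ-<; *-suc; *-zeroʳ; n<1+n; ≤-<-trans; *-cancelˡ-<; *-cancelˡ-≤; <⇒≤pred; pred[m∸n]≡m∸[1+n]; ≰⇒>; +-suc; suc-injective; m∸n≤m; m∸n+n≡m; m≤n⇒m⊓n≡m; m+[n∸m]≡n; module ≤-Reasoning)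
open import Data.Nat.ListAction using (sum)
open import Data.Nat.Tactic.RingSolver using (solve-∀)
open import Data.Bool using (Bool; true; false; if_then_else_; _∧_; _∨_; not)
open import Data.Bool.Properties using (∧-zeroʳ; ∧-identityʳ; ∨-zeroʳ; ∨-identityʳ; T-≡)
open import Data.Fin using (Fin; zero; suc; toℕ; fromℕ<; _≟_) renaming (_<_ to _<ᶠ_)
open import Data.Fin.Properties using (toℕ-injective; toℕ-fromℕ<; toℕ<n; all?)
open import Data.Fin.Subset using (Subset; _∈_; _∉_; ∣_∣; _-_; _─_; _∪_; ⁅_⁆; ⊥)
open import Data.Fin.Subset.Properties using (_∈?_; ∪-identityʳ; drop-not-there)
open import Data.Vec using ([]; _∷_; tabulate)
open import Data.Vec.Properties using (lookup-replicate; lookup-zipWith; []=⇒lookup; lookup⇒[]=; tabulate∘lookup; tabulate-cong)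
open import Data.List using (List; []; _∷_; map; take; lookup; length; replicate; _++_; allFin; filterᵇ)
open import Data.List.Properties using (map-tabulate; map-cong; length-map; length-take; length-++; length-replicate)
open import Data.List.Membership.Propositional using () renaming (_∈_ to _∈ₗ_)
open import Data.List.Membership.Propositional.Properties using (∈-++⁺ˡ; ∈-++⁺ʳ; ∈-map⁺; ∈-filter⁺; ∈-filter⁻; ∈-allFin; ∈-lookup)
open import Data.List.Relation.Unary.Any using (here; there)
open import Data.List.Relation.Unary.All using (All; []; _∷_)
import Data.List.Relation.Unary.All as All
import Data.List.Relation.Unary.All.Properties as AllP
open import Data.List.Relation.Unary.AllPairs using (AllPairs; []; _∷_)
import Data.List.Relation.Unary.AllPairs as AllPairs
import Data.List.Relation.Unary.AllPairs.Properties as AllPairs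
open import Data.List.Relation.Binary.Pointwise using (Pointwise; []; _∷_)
open import Data.List.Relation.Binary.Permutation.Propositional using (_↭_; ↭-refl; ↭-sym; ↭-trans; prep; swap)
open import Data.List.Relation.Binary.Permutation.Propositional.Properties using (↭-length; ∈-resp-↭; All-resp-↭; drop-∷) renaming (map⁺ to ↭-map⁺)
import Data.Integer as ℤ
import Data.Integer.Properties as ℤP
import Data.Integer.Tactic.RingSolver as ℤSolver
open import Data.List.Extrema ℤP.≤-totalOrder using (argmax; f[xs]≤f[argmax])
open import Data.Rational using (ℚ) renaming (_≤_ to _≤ℚ_)
import Data.Rational.Properties as ℚ
open import Relation.Binary.Bundles using (DecTotalOrder)
open DecTotalOrder ℚ.≤-decTotalOrder using (totalOrder)
open import Data.List.Relation.Unary.Sorted.TotalOrder totalOrder using (Sorted)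
open import Data.List.Relation.Unary.Sorted.TotalOrder.Properties using (Sorted⇒AllPairs)
open import Data.List.Sort ℚ.≤-decTotalOrder using (sort-↭; sort-↗)
open import Data.Product using (Σ; _×_; _,_; proj₁; proj₂)
open import Data.Sum using (_⊎_; inj₁; inj₂)
open import Data.Empty using (⊥-elim)
open import Function using (Equivalence; mk⇔; _∘_)
open import Relation.Binary.Definitions using (tri<; tri≈; tri>)
open import Relation.Nullary using (¬_; Dec)
open import Relation.Nullary.Decidable using (⌊_⌋; yes; no; T?; dec-true; isYes≗does; _×-dec_; _→-dec_; toWitness)
open import Relation.Binary.PropositionalEquality

private variable
  A B : Set
  n : ℕ

-- Finite sums

∑ : List A → (A → ℕ) → ℕ
∑ xs f = sum (map f xs)

syntax ∑ xs (λ x → e) = ∑[ x ∈ xs ] e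

∑-zero : (xs : List A) → ∑[ x ∈ xs ] 0 ≡ 0
∑-zero []       = refl
∑-zero (_ ∷ xs) = ∑-zero xs

∑-distrib-+ : (xs : List A) (f g : A → ℕ) → ∑[ x ∈ xs ] (f x + g x) ≡ ∑ xs f + ∑ xs g
∑-distrib-+ []       f g = refl
∑-distrib-+ (x ∷ xs) f g = begin
  f x + g x + ∑[ x ∈ xs ] (f x + g x) ≡⟨ cong (f x + g x +_) (∑-distrib-+ xs f g) ⟩
  f x + g x + (∑ xs f + ∑ xs g)       ≡⟨ interchange (f x) (g x) (∑ xs f) (∑ xs g) ⟩
  f x + ∑ xs f + (g x + ∑ xs g)       ∎
  where
  open ≡-Reasoning
  interchange : ∀ a b c d → a + b + (c + d) ≡ a + c + (b + d)
  interchange = solve-∀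

∑-cong : (xs : List A) {f g : A → ℕ} → (∀ {x} → x ∈ₗ xs → f x ≡ g x) → ∑ xs f ≡ ∑ xs g
∑-cong []       h = refl
∑-cong (x ∷ xs) h = cong₂ _+_ (h (here refl)) (∑-cong xs (h ∘ there))

∑-cong-≗ : (xs : List A) {f g : A → ℕ} → (∀ x → f x ≡ g x) → ∑ xs f ≡ ∑ xs g
∑-cong-≗ xs h = cong sum (map-cong h xs)

∑∑-distrib-+ : (xs : List A) (ys : List B) (F G : A → B → ℕ) →
  ∑[ x ∈ xs ] ∑[ y ∈ ys ] (F x y + G x y) ≡ ∑[ x ∈ xs ] ∑[ y ∈ ys ] F x y + ∑[ x ∈ xs ] ∑[ y ∈ ys ] G x y
∑∑-distrib-+ xs ys F G =
  trans (∑-cong-≗ xs (λ x → ∑-distrib-+ ys (F x) (G x))) (∑-distrib-+ xs _ _)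

∑-mono-≤ : (xs : List A) {f g : A → ℕ} → (∀ x → f x ≤ g x) → ∑ xs f ≤ ∑ xs g
∑-mono-≤ []       h = z≤n
∑-mono-≤ (x ∷ xs) h = +-mono-≤ (h x) (∑-mono-≤ xs h)

∑-comm : (xs : List A) (ys : List B) (F : A → B → ℕ) →
         ∑[ x ∈ xs ] ∑[ y ∈ ys ] F x y ≡ ∑[ y ∈ ys ] ∑[ x ∈ xs ] F x y
∑-comm []       ys F = sym (∑-zero ys)
∑-comm (x ∷ xs) ys F =
  trans (cong (∑ ys (F x) +_) (∑-comm xs ys F)) (sym (∑-distrib-+ ys (F x) _))

term≤∑ : {xs : List A} (f : A → ℕ) {x : A} → x ∈ₗ xs → f x ≤ ∑ xs f
term≤∑ f (here refl) = m≤m+n _ _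
term≤∑ f (there x∈) = ≤-trans (term≤∑ f x∈) (m≤n+m _ _)

∑-take-≤ : ∀ i (xs : List A) (f : A → ℕ) → ∑ (take i xs) f ≤ ∑ xs f
∑-take-≤ zero    xs       f = z≤n
∑-take-≤ (suc i) []       f = z≤n
∑-take-≤ (suc i) (x ∷ xs) f = +-monoʳ-≤ (f x) (∑-take-≤ i xs f)

∑-filterᵇ : (P : A → Bool) (xs : List A) (f : A → ℕ) →
            ∑ (filterᵇ P xs) f ≡ ∑[ x ∈ xs ] (if P x then f x else 0)
∑-filterᵇ P []       f = refl
∑-filterᵇ P (x ∷ xs) f with P x
... | true  = cong (f x +_) (∑-filterᵇ P xs f)
... | false = ∑-filterᵇ P xs f

∑-allFin-suc : ∀ n (f : Fin (suc n) → ℕ) → ∑ (allFin (suc n)) f ≡ f zero + ∑[ i ∈ allFin n ] f (suc i)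
∑-allFin-suc n f = cong (λ xs → f zero + sum xs)
  (trans (map-tabulate suc f) (sym (map-tabulate (λ i → i) (λ i → f (suc i)))))

isYes-suc≟suc : ∀ {n} (i x : Fin n) → ⌊ suc i ≟ suc x ⌋ ≡ ⌊ i ≟ x ⌋
isYes-suc≟suc i x with i ≟ x
... | yes _ = refl
... | no  _ = refl

∑-allFin-δ : ∀ {n} (x : Fin n) (f : Fin n → ℕ) → ∑[ i ∈ allFin n ] (if ⌊ i ≟ x ⌋ then f i else 0) ≡ f x
∑-allFin-δ {suc n} zero f = begin
  ∑[ i ∈ allFin (suc n) ] (if ⌊ i ≟ zero ⌋ then f i else 0) ≡⟨ ∑-allFin-suc n _ ⟩
  f zero + ∑[ i ∈ allFin n ] 0                              ≡⟨ cong (f zero +_) (∑-zero (allFin n)) ⟩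
  f zero + 0                                                ≡⟨ +-identityʳ _ ⟩
  f zero                                                    ∎
  where open ≡-Reasoning
∑-allFin-δ {suc n} (suc x) f = begin
  ∑[ i ∈ allFin (suc n) ] (if ⌊ i ≟ suc x ⌋ then f i else 0)
    ≡⟨ ∑-allFin-suc n (λ i → if ⌊ i ≟ suc x ⌋ then f i else 0) ⟩
  ∑[ i ∈ allFin n ] (if ⌊ suc i ≟ suc x ⌋ then f (suc i) else 0)
    ≡⟨ ∑-cong-≗ (allFin n) (λ i → cong (λ b → if b then f (suc i) else 0) (isYes-suc≟suc i x)) ⟩
  ∑[ i ∈ allFin n ] (if ⌊ i ≟ x ⌋ then f (suc i) else 0)
    ≡⟨ ∑-allFin-δ x (λ i → f (suc i)) ⟩
  f (suc x) ∎
  where open ≡-Reasoning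

-- Subsets as boolean vectors

∈⇒inK : {p : Subset n} {x : Fin n} → x ∈ p → inK p x ≡ true
∈⇒inK = []=⇒lookup

inK⇒∈ : {p : Subset n} {x : Fin n} → inK p x ≡ true → x ∈ p
inK⇒∈ {p = p} {x} = lookup⇒[]= x p

∉⇒inK : {p : Subset n} {x : Fin n} → x ∉ p → inK p x ≡ false
∉⇒inK {p = p} {x} x∉p with inK p x in eq
... | true  = ⊥-elim (x∉p (inK⇒∈ eq))
... | false = refl

inK-⁅⁆ : (y u : Fin n) → inK ⁅ y ⁆ u ≡ ⌊ u ≟ y ⌋
inK-⁅⁆ zero    zero    = refl
inK-⁅⁆ zero    (suc u) = lookup-replicate u false
inK-⁅⁆ (suc y) zero    = refl
inK-⁅⁆ (suc y) (suc u) = trans (inK-⁅⁆ y u) (sym (isYes-suc≟suc u y))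

inK-─ : (p q : Subset n) (u : Fin n) → inK (p ─ q) u ≡ inK p u ∧ not (inK q u)
inK-─ (b ∷ p) (true  ∷ q) zero    = sym (∧-zeroʳ b)
inK-─ (b ∷ p) (false ∷ q) zero    = sym (∧-identityʳ b)
inK-─ (_ ∷ p) (_ ∷ q)     (suc u) = inK-─ p q u

inK-- : (p : Subset n) (y u : Fin n) → inK (p - y) u ≡ inK p u ∧ not ⌊ u ≟ y ⌋
inK-- p y u = trans (inK-─ p ⁅ y ⁆ u) (cong (λ b → inK p u ∧ not b) (inK-⁅⁆ y u))

inK-∪⁅⁆ : (p : Subset n) (y u : Fin n) → inK (p ∪ ⁅ y ⁆) u ≡ inK p u ∨ ⌊ u ≟ y ⌋
inK-∪⁅⁆ p y u = trans (lookup-zipWith _∨_ u p ⁅ y ⁆) (cong (inK p u ∨_) (inK-⁅⁆ y u))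

inK⇒∉ : {p : Subset n} {x : Fin n} → inK p x ≡ false → x ∉ p
inK⇒∉ eq x∈p with trans (sym eq) (∈⇒inK x∈p)
... | ()

x∉p-x : (p : Subset n) (x : Fin n) → x ∉ p - x
x∉p-x p x = inK⇒∉ (begin
  inK (p - x) x            ≡⟨ inK-- p x x ⟩
  inK p x ∧ not ⌊ x ≟ x ⌋  ≡⟨ cong (λ b → inK p x ∧ not b) (trans (isYes≗does (x ≟ x)) (dec-true (x ≟ x) refl)) ⟩
  inK p x ∧ false          ≡⟨ ∧-zeroʳ _ ⟩
  false                       ∎)
  where open ≡-Reasoning

y∉p⇒y∉p-x : {p : Subset n} {y : Fin n} (x : Fin n) → y ∉ p → y ∉ p - x
y∉p⇒y∉p-x {p = p} {y} x y∉p =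
  inK⇒∉ (trans (inK-- p x y) (cong (_∧ not ⌊ y ≟ x ⌋) (∉⇒inK y∉p)))

p-x∪⁅x⁆≡p : {p : Subset n} {x : Fin n} → x ∈ p → (p - x) ∪ ⁅ x ⁆ ≡ p
p-x∪⁅x⁆≡p {p = p} {x} x∈p = begin
  (p - x) ∪ ⁅ x ⁆                     ≡⟨ tabulate∘lookup _ ⟨
  tabulate (inK ((p - x) ∪ ⁅ x ⁆)) ≡⟨ tabulate-cong pointwise ⟩
  tabulate (inK p)                 ≡⟨ tabulate∘lookup p ⟩
  p                                   ∎
  where
  open ≡-Reasoning
  pointwise : ∀ u → inK ((p - x) ∪ ⁅ x ⁆) u ≡ inK p u
  pointwise u rewrite inK-∪⁅⁆ (p - x) x u | inK-- p x u with u ≟ x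
  ... | yes refl = trans (∨-zeroʳ _) (sym (∈⇒inK x∈p))
  ... | no  _    = trans (∨-identityʳ _) (∧-identityʳ _)

∣p∪⁅x⁆∣≡1+∣p∣ : {p : Subset n} {x : Fin n} → x ∉ p → ∣ p ∪ ⁅ x ⁆ ∣ ≡ suc ∣ p ∣
∣p∪⁅x⁆∣≡1+∣p∣ {p = true  ∷ p} {zero}  x∉p = ⊥-elim (x∉p (inK⇒∈ refl))
∣p∪⁅x⁆∣≡1+∣p∣ {p = false ∷ p} {zero}  x∉p = cong (λ q → suc ∣ q ∣) (∪-identityʳ p)
∣p∪⁅x⁆∣≡1+∣p∣ {p = true  ∷ p} {suc x} x∉p = cong suc (∣p∪⁅x⁆∣≡1+∣p∣ (drop-not-there x∉p))
∣p∪⁅x⁆∣≡1+∣p∣ {p = false ∷ p} {suc x} x∉p = ∣p∪⁅x⁆∣≡1+∣p∣ (drop-not-there x∉p)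

γ-term : (p : ℕ) (w : Fin n → Fin n → ℕ) → Subset n → Fin n → Fin n → ℕ
γ-term p w K x y = if inK K y ∧ not ⌊ y ≟ x ⌋ then wt p w x y else 0

γ-remove-self : (p : ℕ) (w : Fin n → Fin n → ℕ) (K : Subset n) (y : Fin n) → γ p w (K - y) y ≡ γ p w K y
γ-remove-self {n} p w K y = ∑-cong-≗ (allFin n) same-term
  where
  same-term : ∀ u → γ-term p w (K - y) y u ≡ γ-term p w K y u
  same-term u rewrite inK-- K y u with u ≟ y
  ... | yes _ = cong (λ b → if b then wt p w y u else 0) (trans (∧-zeroʳ _) (sym (∧-zeroʳ _)))
  ... | no  _ = cong (λ b → if b then wt p w y u else 0) (∧-identityʳ _)

<ᵇ-true : ∀ {m n} → m < n → (m <ᵇ n) ≡ true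
<ᵇ-true m<n = Equivalence.to T-≡ (<⇒<ᵇ m<n)

<ᵇ-false : ∀ {m n} → ¬ (m < n) → (m <ᵇ n) ≡ false
<ᵇ-false {m} {n} m≮n with m <ᵇ n in eq
... | false = refl
... | true  = ⊥-elim (m≮n (<ᵇ⇒< m n (Equivalence.from T-≡ eq)))

module _ {n : ℕ} (p : ℕ) (w : Fin n → Fin n → ℕ) where

  wtPair : Subset n → Fin n → Fin n → ℕ
  wtPair K x y = if inK K x ∧ inK K y ∧ (toℕ x <ᵇ toℕ y) then wt p w x y else 0

  wtPair-outsideˡ : (K : Subset n) {x : Fin n} → x ∉ K → ∀ y → wtPair K x y ≡ 0
  wtPair-outsideˡ K x∉K y rewrite ∉⇒inK x∉K = refl

  wtPair-outsideʳ : (K : Subset n) {y : Fin n} → y ∉ K → ∀ x → wtPair K x y ≡ 0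
  wtPair-outsideʳ K y∉K x rewrite ∉⇒inK y∉K | ∧-zeroʳ (inK K x) = refl

  wtLater wtEarlier : Subset n → Fin n → Fin n → ℕ
  wtLater   K x y = if inK K y ∧ (toℕ x <ᵇ toℕ y) then wt p w x y else 0
  wtEarlier K x u = if inK K u ∧ (toℕ u <ᵇ toℕ x) then wt p w u x else 0

  wtPair-insert : (K : Subset n) {x : Fin n} → x ∉ K → ∀ u y →
    wtPair (K ∪ ⁅ x ⁆) u y ≡ wtPair K u y + (if ⌊ u ≟ x ⌋ then wtLater K x y else 0)
                                          + (if ⌊ y ≟ x ⌋ then wtEarlier K x u else 0)
  wtPair-insert K {x} x∉K u y
    rewrite inK-∪⁅⁆ K x u | inK-∪⁅⁆ K x y with u ≟ x | y ≟ x
  ... | yes refl | yes refl rewrite ∉⇒inK x∉K | <ᵇ-false (n≮n (toℕ u)) = refl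
  ... | yes refl | no _     rewrite ∉⇒inK x∉K | ∨-identityʳ (inK K y) = sym (+-identityʳ _)
  ... | no _     | yes refl rewrite ∉⇒inK x∉K | ∨-identityʳ (inK K u) | ∧-zeroʳ (inK K u) = refl
  ... | no _     | no _     rewrite ∨-identityʳ (inK K u) | ∨-identityʳ (inK K y) =
    sym (trans (+-identityʳ _) (+-identityʳ _))

  later+earlier≡γ-term : (∀ x y → w x y ≡ w y x) → (K : Subset n) {x : Fin n} → x ∉ K → ∀ y →
    wtLater K x y + wtEarlier K x y ≡ γ-term p w K x y
  later+earlier≡γ-term symm K {x} x∉K y with inK K y in y∈K
  ... | false = refl
  ... | true with y ≟ x
  ...   | yes refl = ⊥-elim (x∉K (inK⇒∈ y∈K))
  ...   | no y≢x with <-cmp (toℕ y) (toℕ x)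
  ...     | tri< y<x _ _ rewrite <ᵇ-true y<x | <ᵇ-false (<⇒≯ y<x) = cong (p ∸_) (symm y x)
  ...     | tri≈ _ y≡x _ = ⊥-elim (y≢x (toℕ-injective y≡x))
  ...     | tri> _ _ x<y rewrite <ᵇ-true x<y | <ᵇ-false (<⇒≯ x<y) = +-identityʳ _

  wtK-insert : (∀ x y → w x y ≡ w y x) → (K : Subset n) {x : Fin n} → x ∉ K →
               wtK p w (K ∪ ⁅ x ⁆) ≡ wtK p w K + γ p w K x
  wtK-insert symm K {x} x∉K = begin
    ∑[ u ∈ V ] ∑[ y ∈ V ] wtPair (K ∪ ⁅ x ⁆) u y
      ≡⟨ ∑-cong-≗ V (λ u → ∑-cong-≗ V (wtPair-insert K x∉K u)) ⟩
    ∑[ u ∈ V ] ∑[ y ∈ V ] (wtPair K u y + row u y + column u y)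
      ≡⟨ ∑∑-distrib-+ V V _ column ⟩
    ∑[ u ∈ V ] ∑[ y ∈ V ] (wtPair K u y + row u y) + ∑[ u ∈ V ] ∑[ y ∈ V ] column u y
      ≡⟨ cong₂ _+_ (∑∑-distrib-+ V V (wtPair K) row) earlier-sum ⟩
    wtK p w K + ∑[ u ∈ V ] ∑[ y ∈ V ] row u y + ∑ V (wtEarlier K x)
      ≡⟨ cong (λ a → wtK p w K + a + ∑ V (wtEarlier K x)) later-sum ⟩
    wtK p w K + ∑ V (wtLater K x) + ∑ V (wtEarlier K x)
      ≡⟨ +-assoc (wtK p w K) _ _ ⟩
    wtK p w K + (∑ V (wtLater K x) + ∑ V (wtEarlier K x))
      ≡⟨ cong (wtK p w K +_) (∑-distrib-+ V (wtLater K x) (wtEarlier K x)) ⟨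
    wtK p w K + ∑[ y ∈ V ] (wtLater K x y + wtEarlier K x y)
      ≡⟨ cong (wtK p w K +_) (∑-cong-≗ V (later+earlier≡γ-term symm K x∉K)) ⟩
    wtK p w K + γ p w K x ∎
    where
    open ≡-Reasoning
    V = allFin n
    row column : Fin n → Fin n → ℕ
    row u y = if ⌊ u ≟ x ⌋ then wtLater K x y else 0
    column u y = if ⌊ y ≟ x ⌋ then wtEarlier K x u else 0
    later-sum : ∑[ u ∈ V ] ∑[ y ∈ V ] row u y ≡ ∑ V (wtLater K x)
    later-sum = trans (∑-comm V V row) (∑-cong-≗ V (λ y → ∑-allFin-δ x (λ _ → wtLater K x y)))
    earlier-sum : ∑[ u ∈ V ] ∑[ y ∈ V ] column u y ≡ ∑ V (wtEarlier K x)
    earlier-sum = ∑-cong-≗ V (λ u → ∑-allFin-δ x (λ _ → wtEarlier K x u))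

-- The extremal set

subsets : (n : ℕ) → List (Subset n)
subsets zero    = [] ∷ []
subsets (suc n) = map (true ∷_) (subsets n) ++ map (false ∷_) (subsets n)

∈-subsets : ∀ {n} (K : Subset n) → K ∈ₗ subsets n
∈-subsets []          = here refl
∈-subsets (true  ∷ K) = ∈-++⁺ˡ (∈-map⁺ (true ∷_) (∈-subsets K))
∈-subsets (false ∷ K) = ∈-++⁺ʳ (map (true ∷_) (subsets _)) (∈-map⁺ (false ∷_) (∈-subsets K))

a-b≤c-d⇒a+d≤c+b : ∀ a b c d → ℤ.+ a ℤ.- ℤ.+ b ℤ.≤ ℤ.+ c ℤ.- ℤ.+ d → a + d ≤ c + b
a-b≤c-d⇒a+d≤c+b a b c d h = ℤP.drop‿+≤+ (begin
  ℤ.+ (a + d)                                ≡⟨ ℤP.pos-+ a d ⟩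
  ℤ.+ a ℤ.+ ℤ.+ d                            ≡⟨ shift (ℤ.+ a) (ℤ.+ b) (ℤ.+ d) ⟩
  (ℤ.+ a ℤ.- ℤ.+ b) ℤ.+ (ℤ.+ b ℤ.+ ℤ.+ d)    ≤⟨ ℤP.+-monoˡ-≤ (ℤ.+ b ℤ.+ ℤ.+ d) h ⟩
  (ℤ.+ c ℤ.- ℤ.+ d) ℤ.+ (ℤ.+ b ℤ.+ ℤ.+ d)    ≡⟨ shift′ (ℤ.+ c) (ℤ.+ d) (ℤ.+ b) ⟩
  ℤ.+ c ℤ.+ ℤ.+ b                            ≡⟨ ℤP.pos-+ c b ⟨
  ℤ.+ (c + b)                                ∎)
  where
  open ℤP.≤-Reasoning
  shift : ∀ x y z → x ℤ.+ z ≡ (x ℤ.- y) ℤ.+ (y ℤ.+ z)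
  shift = ℤSolver.solve-∀
  shift′ : ∀ x y z → (x ℤ.- y) ℤ.+ (z ℤ.+ y) ≡ x ℤ.+ z
  shift′ = ℤSolver.solve-∀

maximise-difference : {A : Set} (f g : A → ℕ) (x₀ : A) (xs : List A) →
  Σ A (λ a → ∀ {b} → b ∈ₗ xs → f b + g a ≤ f a + g b)
maximise-difference f g x₀ xs = a , λ {b} b∈xs →
  a-b≤c-d⇒a+d≤c+b (f b) (g b) (f a) (g a) (All.lookup (f[xs]≤f[argmax] x₀ xs) b∈xs)
  where a = argmax (λ x → ℤ.+ f x ℤ.- ℤ.+ g x) x₀ xs

2m≤1+2n⇒m≤n : ∀ {m n} → 2 * m ≤ suc (2 * n) → m ≤ n
2m≤1+2n⇒m≤n {m} {n} h =
  ≤-pred (*-cancelˡ-< 2 m (suc n) (≤-<-trans h (subst (suc (2 * n) <_) (sym (*-suc 2 n)) (n<1+n _))))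

module _ {n : ℕ} (p : ℕ) (w : Fin n → Fin n → ℕ) (symm : ∀ x y → w x y ≡ w y x) where

  reward cost : Subset n → ℕ
  reward K = 2 * p * ∣ K ∣
  cost   K = 2 * wtK p w K + ∣ K ∣

  Maximiser : Subset n → Set
  Maximiser K = ∀ K′ → reward K′ + cost K ≤ reward K + cost K′

  maximiser : Σ (Subset n) Maximiser
  maximiser = proj₁ best , λ K′ → proj₂ best (∈-subsets K′)
    where best = maximise-difference reward cost ⊥ (subsets n)

  reward-insert : {K : Subset n} {x : Fin n} → x ∉ K → reward (K ∪ ⁅ x ⁆) ≡ reward K + 2 * p
  reward-insert {K} x∉K rewrite ∣p∪⁅x⁆∣≡1+∣p∣ x∉K = trans (*-suc (2 * p) ∣ K ∣) (+-comm (2 * p) _)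

  cost-insert : {K : Subset n} {x : Fin n} → x ∉ K → cost (K ∪ ⁅ x ⁆) ≡ cost K + suc (2 * γ p w K x)
  cost-insert {K} {x} x∉K rewrite ∣p∪⁅x⁆∣≡1+∣p∣ x∉K | wtK-insert p w symm K x∉K =
    regroup (wtK p w K) (γ p w K x) ∣ K ∣
    where
    regroup : ∀ a b c → 2 * (a + b) + suc c ≡ 2 * a + c + suc (2 * b)
    regroup = solve-∀

  module _ {K : Subset n} (max : Maximiser K) where

    maximiser-outside : {x : Fin n} → x ∉ K → p ≤ γ p w K x
    maximiser-outside {x} x∉K = 2m≤1+2n⇒m≤n (+-cancelˡ-≤ (reward K + cost K) _ _ (begin
      reward K + cost K + 2 * p               ≡⟨ regroup (reward K) (cost K) (2 * p) ⟩
      reward K + 2 * p + cost K               ≡⟨ cong (_+ cost K) (reward-insert x∉K) ⟨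
      reward (K ∪ ⁅ x ⁆) + cost K             ≤⟨ max (K ∪ ⁅ x ⁆) ⟩
      reward K + cost (K ∪ ⁅ x ⁆)             ≡⟨ cong (reward K +_) (cost-insert x∉K) ⟩
      reward K + (cost K + suc (2 * γ p w K x)) ≡⟨ +-assoc (reward K) _ _ ⟨
      reward K + cost K + suc (2 * γ p w K x) ∎))
      where
      open ≤-Reasoning
      regroup : ∀ a b c → a + b + c ≡ a + c + b
      regroup = solve-∀

    maximiser-inside : {y : Fin n} → y ∈ K → γ p w K y ≤ p ∸ 1
    maximiser-inside {y} y∈K = subst (γ p w K y ≤_) (pred[m∸n]≡m∸[1+n] p 0) (<⇒≤pred
      (subst (_< p) (γ-remove-self p w K y) (*-cancelˡ-< 2 _ _ (+-cancelˡ-≤ (reward K₀ + cost K₀) _ _ (begin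
      reward K₀ + cost K₀ + suc (2 * γ p w K₀ y)   ≡⟨ +-assoc (reward K₀) _ _ ⟩
      reward K₀ + (cost K₀ + suc (2 * γ p w K₀ y)) ≡⟨ cong (reward K₀ +_) (cost-insert y∉K₀) ⟨
      reward K₀ + cost (K₀ ∪ ⁅ y ⁆)               ≡⟨ cong (λ L → reward K₀ + cost L) K₀∪y≡K ⟩
      reward K₀ + cost K                          ≤⟨ max K₀ ⟩
      reward K + cost K₀                          ≡⟨ cong (λ L → reward L + cost K₀) K₀∪y≡K ⟨
      reward (K₀ ∪ ⁅ y ⁆) + cost K₀               ≡⟨ cong (_+ cost K₀) (reward-insert y∉K₀) ⟩
      reward K₀ + 2 * p + cost K₀                 ≡⟨ regroup (reward K₀) (2 * p) (cost K₀) ⟩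
      reward K₀ + cost K₀ + 2 * p                 ∎)))))
      where
      open ≤-Reasoning
      K₀ = K - y
      y∉K₀ = x∉p-x K y
      K₀∪y≡K = p-x∪⁅x⁆≡p y∈K
      regroup : ∀ a b c → a + b + c ≡ a + c + b
      regroup = solve-∀

    maximiser-exchange : {x y : Fin n} → x ∉ K → y ∈ K → γ p w K y ≤ γ p w (K - y) x
    maximiser-exchange {x} {y} x∉K y∈K = subst (_≤ γ p w K₀ x) (γ-remove-self p w K y)
      (*-cancelˡ-≤ 2 (≤-pred (+-cancelˡ-≤ (R₀ + 2 * p + C₀) _ _ (begin
      R₀ + 2 * p + C₀ + suc (2 * γ p w K₀ y)
        ≡⟨ +-assoc (R₀ + 2 * p) _ _ ⟩
      R₀ + 2 * p + (C₀ + suc (2 * γ p w K₀ y))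
        ≡⟨ cong₂ _+_ (reward-insert x∉K₀) (cost-insert y∉K₀) ⟨
      reward (K₀ ∪ ⁅ x ⁆) + cost (K₀ ∪ ⁅ y ⁆)
        ≡⟨ cong (λ L → reward (K₀ ∪ ⁅ x ⁆) + cost L) K₀∪y≡K ⟩
      reward (K₀ ∪ ⁅ x ⁆) + cost K
        ≤⟨ max (K₀ ∪ ⁅ x ⁆) ⟩
      reward K + cost (K₀ ∪ ⁅ x ⁆)
        ≡⟨ cong (λ L → reward L + cost (K₀ ∪ ⁅ x ⁆)) K₀∪y≡K ⟨
      reward (K₀ ∪ ⁅ y ⁆) + cost (K₀ ∪ ⁅ x ⁆)
        ≡⟨ cong₂ _+_ (reward-insert y∉K₀) (cost-insert x∉K₀) ⟩
      R₀ + 2 * p + (C₀ + suc (2 * γ p w K₀ x))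
        ≡⟨ +-assoc (R₀ + 2 * p) _ _ ⟨
      R₀ + 2 * p + C₀ + suc (2 * γ p w K₀ x)
        ∎))))
      where
      open ≤-Reasoning
      K₀ = K - y
      R₀ = reward K₀
      C₀ = cost K₀
      y∉K₀ = x∉p-x K y
      x∉K₀ = y∉p⇒y∉p-x y x∉K
      K₀∪y≡K = p-x∪⁅x⁆≡p y∈K

-- The extension along the increasing enumeration of K

enumerate : Subset n → List (Fin n)
enumerate {n} K = filterᵇ (inK K) (allFin n)

enumerate-increasing : (K : Subset n) → AllPairs _<ᶠ_ (enumerate K)
enumerate-increasing K = AllPairs.filter⁺ (T? ∘ inK K) (AllPairs.tabulate⁺-< (λ i<j → i<j))

∈-enumerate : (K : Subset n) (x : Fin n) → x ∈ₗ enumerate K → x ∈ K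
∈-enumerate {n} K x x∈ =
  inK⇒∈ (Equivalence.to T-≡ (proj₂ (∈-filter⁻ (T? ∘ inK K) {xs = allFin n} x∈)))

enumerate-enumeration : (K : Subset n) → Enumeration K (enumerate K)
enumerate-enumeration K =
  AllPairs.map (λ u<v u≡v → <-irrefl (cong toℕ u≡v) u<v) (enumerate-increasing K) ,
  λ x → mk⇔ (∈-enumerate K x)
             (λ x∈K → ∈-filter⁺ (T? ∘ inK K) (∈-allFin x) (Equivalence.from T-≡ (∈⇒inK x∈K)))

∑-enumerate : (K : Subset n) (f : Fin n → ℕ) →
              ∑ (enumerate K) f ≡ ∑[ x ∈ allFin n ] (if inK K x then f x else 0)
∑-enumerate {n} K = ∑-filterᵇ (inK K) (allFin n)

∑-enumerate-const : (K : Subset n) (c : ℕ) → ∑[ x ∈ enumerate K ] c ≡ c * ∣ K ∣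
∑-enumerate-const K c = trans (∑-enumerate K (λ _ → c)) (indicator K)
  where
  indicator : ∀ {m} (L : Subset m) → ∑[ x ∈ allFin m ] (if inK L x then c else 0) ≡ c * ∣ L ∣
  indicator []          = sym (*-zeroʳ c)
  indicator {suc m} (true  ∷ L) = trans (∑-allFin-suc m (λ x → if inK (true ∷ L) x then c else 0))
                                        (trans (cong (c +_) (indicator L)) (sym (*-suc c ∣ L ∣)))
  indicator {suc m} (false ∷ L) = trans (∑-allFin-suc m (λ x → if inK (false ∷ L) x then c else 0))
                                        (indicator L)

AllPairs⇒All-take-lookup : {A : Set} {R : A → A → Set} {xs : List A} → AllPairs R xs →
                  (i : Fin (length xs)) → All (λ u → R u (lookup xs i)) (take (toℕ i) xs)
AllPairs⇒All-take-lookup (_ ∷ _)  zero    = []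
AllPairs⇒All-take-lookup (r ∷ rs) (suc i) = All.lookup r (∈-lookup i) ∷ AllPairs⇒All-take-lookup rs i

∑-enumerate-support : (K : Subset n) (f : Fin n → ℕ) → (∀ x → x ∉ K → f x ≡ 0) →
                      ∑ (enumerate K) f ≡ ∑ (allFin n) f
∑-enumerate-support {n} K f f-outside = trans (∑-enumerate K f) (∑-cong-≗ (allFin n) restrict)
  where
  restrict : ∀ x → (if inK K x then f x else 0) ≡ f x
  restrict x with inK K x in x∈?
  ... | true  = refl
  ... | false = sym (f-outside x (inK⇒∉ x∈?))

module _ {n : ℕ} (p : ℕ) (w : Fin n → Fin n → ℕ) where

  earlierWeight : Subset n → Fin n → ℕ
  earlierWeight K v = ∑[ u ∈ allFin n ] wtPair p w K u v

  earlierWeight-outside : (K : Subset n) {v : Fin n} → v ∉ K → earlierWeight K v ≡ 0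
  earlierWeight-outside K v∉K = trans (∑-cong-≗ (allFin n) (wtPair-outsideʳ p w K v∉K)) (∑-zero (allFin n))

  wtK≡∑earlierWeight : (K : Subset n) → wtK p w K ≡ ∑[ v ∈ enumerate K ] earlierWeight K v
  wtK≡∑earlierWeight K = trans (∑-comm (allFin n) (allFin n) (wtPair p w K))
    (sym (∑-enumerate-support K (earlierWeight K) (λ v v∉K → earlierWeight-outside K v∉K)))

  earlierWeight≤γ : (∀ x y → w x y ≡ w y x) → (K : Subset n) (v : Fin n) → earlierWeight K v ≤ γ p w K v
  earlierWeight≤γ symm K v = ∑-mono-≤ (allFin n) term≤
    where
    term≤ : ∀ u → wtPair p w K u v ≤ γ-term p w K v u
    term≤ u with inK K u | inK K v
    ... | false | _     = z≤n
    ... | true  | false = z≤n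
    ... | true  | true with toℕ u <ᵇ toℕ v in u<v
    ...   | false = z≤n
    ...   | true with u ≟ v
    ...     | yes refl = ⊥-elim (<-irrefl refl (<ᵇ⇒< (toℕ u) (toℕ u) (Equivalence.from T-≡ u<v)))
    ...     | no _     = ≤-reflexive (cong (p ∸_) (symm u v))

  ∑-predecessors≤earlierWeight : (K : Subset n) (i : Fin (length (enumerate K))) →
    let L = enumerate K ; v = lookup L i in
    ∑[ u ∈ take (toℕ i) L ] (p ∸ w u v) ≤ earlierWeight K v
  ∑-predecessors≤earlierWeight K i = begin
    ∑[ u ∈ take (toℕ i) L ] (p ∸ w u v)      ≡⟨ ∑-cong (take (toℕ i) L) predecessor-term ⟩
    ∑[ u ∈ take (toℕ i) L ] wtPair p w K u v ≤⟨ ∑-take-≤ (toℕ i) L (λ u → wtPair p w K u v) ⟩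
    ∑[ u ∈ L ] wtPair p w K u v
      ≡⟨ ∑-enumerate-support K _ (λ u u∉K → wtPair-outsideˡ p w K u∉K v) ⟩
    earlierWeight K v                        ∎
    where
    open ≤-Reasoning
    L = enumerate K
    v = lookup L i
    v∈K = ∈-enumerate K v (∈-lookup i)
    predecessor-term : ∀ {u} → u ∈ₗ take (toℕ i) L → p ∸ w u v ≡ wtPair p w K u v
    predecessor-term u∈
      rewrite ∈⇒inK (All.lookup (AllP.take⁺ (toℕ i) (All.tabulate (∈-enumerate K _))) u∈)
            | ∈⇒inK v∈K
            | <ᵇ-true (All.lookup (AllPairs⇒All-take-lookup (enumerate-increasing K) i) u∈) = refl

-- Domination

n<2[1+⌊n/2⌋] : ∀ n → n < suc ⌊ n /2⌋ + suc ⌊ n /2⌋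
n<2[1+⌊n/2⌋] zero          = s≤s z≤n
n<2[1+⌊n/2⌋] (suc zero)    = s≤s (s≤s z≤n)
n<2[1+⌊n/2⌋] (suc (suc n)) =
  s≤s (subst (suc n <_) (sym (+-suc (suc ⌊ n /2⌋) (suc ⌊ n /2⌋))) (s≤s (n<2[1+⌊n/2⌋] n)))

all-but-one-small : {A : Set} (d : A → ℕ) (xs : List A) {s D : ℕ} →
  ∑ xs d ≤ s → s < suc D + suc D → 0 < length xs →
  Σ A (λ m → Σ (List A) (λ rest → (xs ↭ m ∷ rest) × All (λ u → d u ≤ D) rest))
all-but-one-small d (x ∷ xs) {s} {D} ∑≤s s<2D+2 _ with d x ≤ℕ? D
all-but-one-small d (x ∷ []) ∑≤s s<2D+2 _ | yes _ = x , [] , ↭-refl , []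
all-but-one-small d (x ∷ y ∷ ys) ∑≤s s<2D+2 _ | yes dx≤D
  with all-but-one-small d (y ∷ ys) (≤-trans (m≤n+m _ (d x)) ∑≤s) s<2D+2 (s≤s z≤n)
... | m , rest , y∷ys↭ , rest-small =
  m , x ∷ rest , ↭-trans (prep x y∷ys↭) (swap x m ↭-refl) , dx≤D ∷ rest-small
all-but-one-small d (x ∷ xs) {s} {D} ∑≤s s<2D+2 _ | no dx≰D = x , xs , ↭-refl , All.tabulate small
  where
  small : ∀ {u} → u ∈ₗ xs → d u ≤ D
  small {u} u∈xs = ≤-pred (+-cancelˡ-< (suc D) _ _ (begin-strict
    suc D + d u   ≤⟨ +-mono-≤ (≰⇒> dx≰D) (term≤∑ d u∈xs) ⟩
    d x + ∑ xs d  ≤⟨ ∑≤s ⟩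
    s             <⟨ s<2D+2 ⟩
    suc D + suc D ∎))
    where open ≤-Reasoning

sorted-head≤ : ∀ {x xs} → Sorted (x ∷ xs) → All (x ≤ℚ_) xs
sorted-head≤ x∷xs↗ with Sorted⇒AllPairs totalOrder x∷xs↗
... | x≤xs ∷ _ = x≤xs

pointwise-across : ∀ {t} {S T : List ℚ} → All (t ≤ℚ_) S → All (_≤ℚ t) T → length S ≡ length T →
                   Pointwise (λ x y → y ≤ℚ x) S T
pointwise-across {S = []}    {[]}    _          _          _   = []
pointwise-across {S = _ ∷ _} {_ ∷ _} (t≤s ∷ t≤S) (u≤t ∷ T≤t) eq =
  ℚ.≤-trans u≤t t≤s ∷ pointwise-across t≤S T≤t (suc-injective eq)

module _ {a t m : ℚ} {R Y : List ℚ} (a≤m : a ≤ℚ m) (t≤R : All (t ≤ℚ_) R) (a≤t : a ≤ℚ t)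
         (Y≤t : All (_≤ℚ t) Y) (a∈Y : a ∈ₗ Y) where

  sorted-dominates : ∀ {S T} → Sorted S → Sorted T → S ↭ m ∷ R → T ↭ Y → length S ≡ length T →
                     Pointwise (λ x y → y ≤ℚ x) S T
  sorted-dominates {[]}    _  _  S↭ _  _ with ↭-length S↭
  ... | ()
  sorted-dominates {_ ∷ _} {[]} _ _ _ _ ()
  sorted-dominates {s ∷ S} {u ∷ T} S↗ T↗ S↭ T↭ |S|≡|T| =
    ℚ.≤-trans u≤a a≤s ∷
    pointwise-across t≤S (All.tail (All-resp-↭ (↭-sym T↭) Y≤t)) (suc-injective |S|≡|T|)
    where
    u≤a : u ≤ℚ a
    u≤a with ∈-resp-↭ (↭-sym T↭) a∈Y
    ... | here refl = ℚ.≤-refl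
    ... | there a∈T = All.lookup (sorted-head≤ T↗) a∈T
    a≤s : a ≤ℚ s
    a≤s with ∈-resp-↭ S↭ (here refl)
    ... | here refl = a≤m
    ... | there s∈R = ℚ.≤-trans a≤t (All.lookup t≤R s∈R)
    t≤S : All (t ≤ℚ_) S
    t≤S with ∈-resp-↭ S↭ (here refl)
    ... | here refl = All-resp-↭ (↭-sym (drop-∷ S↭)) t≤R
    ... | there s∈R = All.map (ℚ.≤-trans (All.lookup t≤R s∈R)) (sorted-head≤ S↗)

dominates-threshold : ∀ {a t m} {R X : List ℚ} k → X ↭ m ∷ R → a ≤ℚ m → All (t ≤ℚ_) R → a ≤ℚ t →
                      length X ≡ suc k → Dominates X (replicate k t ++ a ∷ [])
dominates-threshold {a} {t} {X = X} k X↭ a≤m t≤R a≤t |X|≡1+k =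
  sorted-dominates a≤m t≤R a≤t Y≤t (∈-++⁺ʳ (replicate k t) (here refl))
    (sort-↗ X) (sort-↗ Y) (↭-trans (sort-↭ X) X↭) (sort-↭ Y)
    (trans (↭-length (sort-↭ X)) (trans |X|≡1+k (sym (trans (↭-length (sort-↭ Y)) |Y|≡1+k))))
  where
  Y = replicate k t ++ a ∷ []
  Y≤t : All (_≤ℚ t) Y
  Y≤t = AllP.++⁺ (AllP.replicate⁺ k ℚ.≤-refl) (a≤t ∷ [])
  |Y|≡1+k : length Y ≡ suc k
  |Y|≡1+k = trans (length-++ (replicate k t)) (trans (cong (_+ 1) (length-replicate k)) (+-comm k 1))

-- With p = suc q and s = b(v): the second bound amounts to p / (p − s) ≥ ⌊s/2⌋ + 1, which is where
-- p ≤ 4 is needed.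
EntryBounds : ℕ → ℕ → ℕ → Set
EntryBounds q s wv =
  (suc q ∸ wv ≤ s → ℕtoℚ (suc (q ∸ s)) ≤ℚ ℕtoℚ wv) ×
  (suc q ∸ wv ≤ ⌊ s /2⌋ → thr (suc q) (q ∸ s) ≤ℚ ℕtoℚ wv) ×
  ℕtoℚ (suc (q ∸ s)) ≤ℚ thr (suc q) (q ∸ s)

entryBounds? : ∀ q s wv → Dec (EntryBounds q s wv)
entryBounds? q s wv =
  ((suc q ∸ wv ≤ℕ? s) →-dec (ℕtoℚ (suc (q ∸ s)) ℚ.≤? ℕtoℚ wv)) ×-dec
  ((suc q ∸ wv ≤ℕ? ⌊ s /2⌋) →-dec (thr (suc q) (q ∸ s) ℚ.≤? ℕtoℚ wv)) ×-dec
  (ℕtoℚ (suc (q ∸ s)) ℚ.≤? thr (suc q) (q ∸ s))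

AllEntryBounds : ℕ → Set
AllEntryBounds q = ∀ (s : Fin (suc q)) (wv : Fin (suc (suc q))) → EntryBounds q (toℕ s) (toℕ wv)

allEntryBounds? : ∀ q → Dec (AllEntryBounds q)
allEntryBounds? q = all? (λ s → all? (λ wv → entryBounds? q (toℕ s) (toℕ wv)))

entry-bounds : ∀ {q} → q ≡ 2 ⊎ q ≡ 3 → ∀ {s wv} → s ≤ q → wv ≤ suc q → EntryBounds q s wv
entry-bounds {q} q∈ s≤q wv≤p =
  subst₂ (EntryBounds q) (toℕ-fromℕ< (s≤s s≤q)) (toℕ-fromℕ< (s≤s wv≤p))
         (checked q∈ (fromℕ< (s≤s s≤q)) (fromℕ< (s≤s wv≤p)))
  where
  checked : q ≡ 2 ⊎ q ≡ 3 → AllEntryBounds q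
  checked (inj₁ refl) = toWitness {a? = allEntryBounds? 2} _
  checked (inj₂ refl) = toWitness {a? = allEntryBounds? 3} _

module _ {q : ℕ} (q∈ : q ≡ 2 ⊎ q ≡ 3) {s : ℕ} (s≤q : s ≤ q) where

  extension≤weight : ∀ {wv} → wv ≤ suc q → suc q ∸ wv ≤ s → ℕtoℚ (suc (q ∸ s)) ≤ℚ ℕtoℚ wv
  extension≤weight wv≤p = proj₁ (entry-bounds q∈ s≤q wv≤p)

  threshold≤weight : ∀ {wv} → wv ≤ suc q → suc q ∸ wv ≤ ⌊ s /2⌋ → thr (suc q) (q ∸ s) ≤ℚ ℕtoℚ wv
  threshold≤weight wv≤p = proj₁ (proj₂ (entry-bounds q∈ s≤q wv≤p))

  extension≤threshold : ℕtoℚ (suc (q ∸ s)) ≤ℚ thr (suc q) (q ∸ s)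
  extension≤threshold = proj₂ (proj₂ (entry-bounds q∈ {wv = 0} s≤q z≤n))

interior-positive : ∀ {n p} (w : Fin n → Fin n → ℕ) (K : Subset n) →
                    (∀ y → y ∈ K → γ p w K y < p) → Positive w K
interior-positive {p = p} w K interior x y x∈K y∈K x≢y with w x y in wxy≡0
... | suc _ = s≤s z≤n
... | zero  = ⊥-elim (<⇒≱ (interior x x∈K) (begin
  p                 ≡⟨ term≡p ⟨
  γ-term p w K x y  ≤⟨ term≤∑ (γ-term p w K x) (∈-allFin y) ⟩
  γ p w K x         ∎))
  where
  open ≤-Reasoning
  term≡p : γ-term p w K x y ≡ p
  term≡p rewrite ∈⇒inK y∈K | wxy≡0 with y ≟ x
  ... | yes refl = ⊥-elim (x≢y refl)
  ... | no  _    = refl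

module _ {n q : ℕ} (w : Fin n → Fin n → ℕ) (W : IsWeighted (suc q) n w) (K : Subset n)
         (interior : ∀ y → y ∈ K → γ (suc q) w K y ≤ q) where

  private
    p = suc q
    L = enumerate K
    earlier = earlierWeight p w K

  earlierWeight≤q : ∀ v → earlier v ≤ q
  earlierWeight≤q v with v ∈? K
  ... | yes v∈K = ≤-trans (earlierWeight≤γ p w (IsWeighted.symm W) K v) (interior v v∈K)
  ... | no  v∉K = subst (_≤ q) (sym (earlierWeight-outside p w K v∉K)) z≤n

  extension : Fin n → Fin p
  extension v = fromℕ< (s≤s (m∸n≤m q (earlier v)))

  extVal-extension : ∀ v → extVal extension v ≡ suc (q ∸ earlier v)
  extVal-extension v = cong suc (toℕ-fromℕ< (s≤s (m∸n≤m q (earlier v))))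

  extSize+wtK≡p*∣K∣ : extSize extension L + wtK p w K ≡ p * ∣ K ∣
  extSize+wtK≡p*∣K∣ = begin
    extSize extension L + wtK p w K
      ≡⟨ cong₂ _+_ (∑-cong-≗ L extVal-extension) (wtK≡∑earlierWeight p w K) ⟩
    ∑[ v ∈ L ] suc (q ∸ earlier v) + ∑ L earlier
      ≡⟨ ∑-distrib-+ L _ earlier ⟨
    ∑[ v ∈ L ] suc (q ∸ earlier v + earlier v)
      ≡⟨ ∑-cong-≗ L (λ v → cong suc (m∸n+n≡m (earlierWeight≤q v))) ⟩
    ∑[ v ∈ L ] p
      ≡⟨ ∑-enumerate-const K p ⟩
    p * ∣ K ∣ ∎
    where open ≡-Reasoning

  extension-dominating : q ≡ 2 ⊎ q ≡ 3 → IsDominating p w L extension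
  extension-dominating q∈ i 1≤i rewrite toℕ-fromℕ< (s≤s (m∸n≤m q (earlier (lookup L i)))) =
    let m , rest , P↭m∷rest , rest-small = split in
    dominates-threshold (toℕ i ∸ 1) (↭-map⁺ weight P↭m∷rest)
      (extension≤weight q∈ s≤q (bounded m v)
        (≤-trans (term≤∑ deficit (∈-resp-↭ (↭-sym P↭m∷rest) (here refl))) ∑deficit≤s))
      (AllP.map⁺ (All.map (λ {u} → threshold≤weight q∈ s≤q (bounded u v)) rest-small))
      (extension≤threshold q∈ s≤q)
      (trans (length-map weight P) (trans |P|≡i (sym (m+[n∸m]≡n 1≤i))))
    where
    bounded = IsWeighted.bounded W
    v = lookup L i
    s = earlier v
    s≤q = earlierWeight≤q v
    P = take (toℕ i) L
    weight : Fin n → ℚ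
    weight u = ℕtoℚ (w u v)
    deficit : Fin n → ℕ
    deficit u = p ∸ w u v
    ∑deficit≤s : ∑ P deficit ≤ s
    ∑deficit≤s = ∑-predecessors≤earlierWeight p w K i
    |P|≡i : length P ≡ toℕ i
    |P|≡i = trans (length-take (toℕ i) L) (m≤n⇒m⊓n≡m (<⇒≤ (toℕ<n i)))
    split = all-but-one-small deficit P ∑deficit≤s (n<2[1+⌊n/2⌋] s) (subst (0 <_) (sym |P|≡i) 1≤i)

  extSize-bound : ℤ.+ (p * ∣ K ∣) ℤ.- ℤ.+ wtK p w K ℤ.≤ ℤ.+ extSize extension L
  extSize-bound = ℤP.≤-reflexive (begin
    ℤ.+ (p * ∣ K ∣) ℤ.- ℤ.+ Wt      ≡⟨ cong (λ z → ℤ.+ z ℤ.- ℤ.+ Wt) extSize+wtK≡p*∣K∣ ⟨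
    ℤ.+ (E + Wt) ℤ.- ℤ.+ Wt        ≡⟨ cong (ℤ._- ℤ.+ Wt) (ℤP.pos-+ E Wt) ⟩
    ℤ.+ E ℤ.+ ℤ.+ Wt ℤ.- ℤ.+ Wt    ≡⟨ cancel (ℤ.+ E) (ℤ.+ Wt) ⟩
    ℤ.+ E                          ∎)
    where
    open ≡-Reasoning
    E = extSize extension L
    Wt = wtK p w K
    cancel : ∀ a b → a ℤ.+ b ℤ.- b ≡ a
    cancel = ℤSolver.solve-∀

  interior⇒InG : q ≡ 2 ⊎ q ≡ 3 → InG p w K (ℤ.+ (p * ∣ K ∣) ℤ.- ℤ.+ wtK p w K)
  interior⇒InG q∈ = interior-positive w K (λ y y∈K → s≤s (interior y y∈K)) ,
    L , enumerate-enumeration K , extension , extension-dominating q∈ , extSize-bound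

-- Opened only here: an unqualified `+_` would make the sections `(a +_)` above ambiguous.
open import Data.Integer using (+_) renaming (_-_ to _-ℤ_)

proposition5p11 : (p : ℕ) → (p ≡ 3 ⊎ p ≡ 4) →
    (n : ℕ) (w : Fin n → Fin n → ℕ) → IsWeighted p n w →
    Σ (Subset n) (λ K →
      InG p w K ((+ (p * ∣ K ∣)) -ℤ (+ wtK p w K))
      × ((∀ y → y ∈ K → γ p w K y ≤ p ∸ 1) × (∀ x → x ∉ K → γ p w K x ≥ p))
      × (∀ x y → x ∉ K → y ∈ K → γ p w (K - y) x ≥ γ p w K y))
proposition5p11 p p∈ n w W =
  K , in-𝒢 p∈ , (inside , outside) , λ x y → maximiser-exchange p w symm max
  where
  symm = IsWeighted.symm W
  K = proj₁ (maximiser p w symm)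
  max = proj₂ (maximiser p w symm)
  inside : ∀ y → y ∈ K → γ p w K y ≤ p ∸ 1
  inside y = maximiser-inside p w symm max
  outside : ∀ x → x ∉ K → γ p w K x ≥ p
  outside x = maximiser-outside p w symm max
  in-𝒢 : p ≡ 3 ⊎ p ≡ 4 → InG p w K ((+ (p * ∣ K ∣)) -ℤ (+ wtK p w K))
  in-𝒢 (inj₁ refl) = interior⇒InG w W K inside (inj₁ refl)
  in-𝒢 (inj₂ refl) = interior⇒InG w W K inside (inj₂ refl)
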